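{- For all fixed integers $r\ge2$ and $s\ge3$ and every positive integer $m$, $N^{\mathrm{F}}_{r,s,s}(m)\le(r-1)\binom{m-2}{s-2}$; in particular $N^{\mathrm{F}}_{r,s,s}(m)=O(m^{s-2})$.
   Context: An $(r,s)$-formation is a concatenation of $s$ permutations of the same set of $r$ distinct symbols; a sequence contains one if some (not necessarily contiguous) subsequence is an $(r,s)$-formation. An $\mathrm{AFF}_{r,s,k}(m)$ sequence is a sequence (not required to be sparse) containing no $(r,s)$-formation, partitionable into at most $m$ contiguous blocks each composed of distinct symbols, in which each symbol appears at least $k$ times. $N^{\mathrm{F}}_{r,s,k}(m)$ is the maximum number of distinct symbols in an $\mathrm{AFF}_{r,s,k}(m)$ sequence. The binomial coefficient $\binom{a}{b}$ is $0$ when $a<b$. -}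

module Defs where

open import Data.Nat using (ℕ; _≤_; _≥_; _≟_)
open import Data.List using (List; length; concat; filter; deduplicate)
open import Data.List.Relation.Unary.All using (All)
open import Data.List.Relation.Unary.Unique.Propositional using (Unique)
open import Data.List.Relation.Binary.Permutation.Propositional using (_↭_)
open import Data.List.Relation.Binary.Sublist.Propositional using (_⊆_)
open import Data.List.Membership.Propositional using (_∈_)
open import Relation.Binary.PropositionalEquality using (_≡_)
open import Data.Empty using (⊥)
open import Data.Product using (Σ; _×_; ∃)

Seq : Set
Seq = List ℕ

IsFormation : ℕ → ℕ → Seq → Set
IsFormation r s f =
  Σ (List ℕ) λ xs → Σ (List (List ℕ)) λ ps →
    (length xs ≡ r) × Unique xs × (length ps ≡ s) × All (_↭ xs) ps × (concat ps ≡ f)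

ContainsFormation : ℕ → ℕ → Seq → Set
ContainsFormation r s u = Σ Seq λ f → (f ⊆ u) × IsFormation r s f

BlockPartitionable : ℕ → Seq → Set
BlockPartitionable m u =
  Σ (List Seq) λ bs → (length bs ≤ m) × (concat bs ≡ u) × All Unique bs

occ : ℕ → Seq → ℕ
occ x u = length (filter (x ≟_) u)

distinct : Seq → ℕ
distinct u = length (deduplicate _≟_ u)

AFF : ℕ → ℕ → ℕ → ℕ → Seq → Set
AFF r s k m u =
  (ContainsFormation r s u → ⊥) × BlockPartitionable m u × (∀ x → x ∈ u → occ x u ≥ k)

module Submission where

-- Let u be an AFF_{r,s,s}(m) sequence with blocks B₁ … Bₘ and let
-- X be its set of symbols.  Blocks are duplicate-free, so every symbol of X
-- lies in at least s blocks.  If |X| > (r-1)·C(m-2, s-2) we find r symbols Y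
-- and a splitting of u into s consecutive segments each containing all of Y
-- (a "chain"); listing, in every segment, the symbols of Y in order of first
-- appearance gives an (r,s)-formation, contradicting the AFF hypothesis.
--
-- The chain is found by induction on the blocks; this is the paper's
-- pigeonhole over (s-2)-sets of middle blocks, unfolded along Pascal's rule
-- C(n+1,k+1) = C(n,k) + C(n,k+1).  Look at the first two blocks P, B.  Symbols
-- lying in both use P as their first segment and need one segment fewer from
-- B on; for all other symbols P and B can be merged into one block without
-- losing a block.  One of the two groups is large enough for the induction.

open import Defs
open import Data.Nat using (ℕ; _≤_; _*_; _∸_)
open import Data.Nat.Combinatorics using (_C_)

open import Data.Nat using (zero; suc; _+_; _<_; _≤′_; ≤′-refl; ≤′-step; z≤n; s≤s; _≤?_; _≟_)
open import Data.Nat.Properties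
open import Data.Nat.Combinatorics using (nCk+nC[k+1]≡[n+1]C[k+1])
open import Data.List using (List; []; _∷_; _++_; length; concat; filter; take; deduplicate)
open import Data.List.Properties using (length-++; filter-++; filter-none; length-take; ++-assoc; ++-identityʳ)
open import Data.List.Relation.Unary.All as All using (All; []; _∷_)
import Data.List.Relation.Unary.All.Properties as All
open import Data.List.Relation.Unary.AllPairs using ([]; _∷_)
open import Data.List.Relation.Unary.Unique.Propositional using (Unique)
import Data.List.Relation.Unary.Unique.Propositional.Properties as Unique
open import Data.List.Relation.Unary.Unique.DecPropositional.Properties _≟_ using (deduplicate-!)
open import Data.List.Relation.Binary.Permutation.Propositional using (_↭_)
open import Data.List.Relation.Binary.BagAndSetEquality using (∼bag⇒↭)
open import Data.List.Relation.Binary.Sublist.Propositional using (_⊆_; []; _∷_; ⊆-trans)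
open import Data.List.Relation.Binary.Sublist.Propositional.Properties using (++⁺; filter-⊆)
open import Data.List.Membership.Propositional using (_∈_)
open import Data.List.Membership.Propositional.Properties
  using (∈-++⁺ˡ; ∈-++⁺ʳ; ∈-filter⁺; ∈-filter⁻; ∈-deduplicate⁺; ∈-deduplicate⁻)
open import Data.List.Membership.Propositional.Properties.WithK using (unique∧set⇒bag)
open import Data.List.Membership.DecPropositional _≟_ using (_∈?_)
open import Data.Product using (Σ; _×_; _,_; proj₁; proj₂)
open import Data.Sum using (_⊎_; inj₁; inj₂)
open import Data.Empty using (⊥-elim)
open import Function using (_∘_)
open import Function.Bundles using (mk⇔)
open import Relation.Binary.PropositionalEquality using (_≡_; refl; sym; trans; cong; subst; subst₂)
open import Relation.Nullary using (Dec; yes; no; ¬_)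
open import Relation.Nullary.Decidable using (_×-dec_; ¬?)

data Chain (Y : List ℕ) : ℕ → Seq → Set where
  last : ∀ {w} → All (_∈ w) Y → Chain Y 1 w
  next : ∀ {t a w} → All (_∈ a) Y → Chain Y t w → Chain Y (suc t) (a ++ w)

deduplicate-⊆ : ∀ xs → deduplicate _≟_ xs ⊆ xs
deduplicate-⊆ []       = []
deduplicate-⊆ (x ∷ xs) = refl ∷ ⊆-trans (filter-⊆ (¬? ∘ (x ≟_)) _) (deduplicate-⊆ xs)

-- A segment a containing all symbols of a duplicate-free Y contains some
-- permutation of Y as a subsequence: the symbols of Y in order of first
-- appearance.  Two duplicate-free lists with the same members are permutations
-- of each other.
permutation-within : ∀ {Y} a → Unique Y → All (_∈ a) Y → Σ (List ℕ) λ p → (p ↭ Y) × (p ⊆ a)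
permutation-within {Y} a Y-unique Y⊆a = p , p↭Y , ⊆-trans (filter-⊆ (_∈? Y) _) (deduplicate-⊆ a)
  where
  p : List ℕ
  p = filter (_∈? Y) (deduplicate _≟_ a)
  p↭Y : p ↭ Y
  p↭Y = ∼bag⇒↭ (unique∧set⇒bag (Unique.filter⁺ (_∈? Y) (deduplicate-! a)) Y-unique
          (mk⇔ (proj₂ ∘ ∈-filter⁻ (_∈? Y) {xs = deduplicate _≟_ a})
               (λ y∈Y → ∈-filter⁺ (_∈? Y) (∈-deduplicate⁺ _≟_ (All.lookup Y⊆a y∈Y)) y∈Y)))

chain-permutations : ∀ {Y t w} → Unique Y → Chain Y t w →
  Σ (List (List ℕ)) λ ps → (length ps ≡ t) × All (_↭ Y) ps × (concat ps ⊆ w)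
chain-permutations {w = w} Y-unique (last Y⊆w) with permutation-within w Y-unique Y⊆w
... | p , p↭Y , p⊆w = p ∷ [] , refl , p↭Y ∷ [] , subst (_⊆ w) (sym (++-identityʳ p)) p⊆w
chain-permutations Y-unique (next {a = a} Y⊆a chain)
  with permutation-within a Y-unique Y⊆a | chain-permutations Y-unique chain
... | p , p↭Y , p⊆a | ps , #ps , ps↭Y , ps⊆w = p ∷ ps , cong suc #ps , p↭Y ∷ ps↭Y , ++⁺ p⊆a ps⊆w

chain⇒formation : ∀ {r t w Y} → Unique Y → length Y ≡ r → Chain Y t w → ContainsFormation r t w
chain⇒formation {Y = Y} Y-unique #Y chain with chain-permutations Y-unique chain
... | ps , #ps , ps↭Y , ps⊆w = concat ps , ps⊆w , Y , ps , #Y , Y-unique , #ps , ps↭Y , refl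

isIn : ℕ → Seq → ℕ
isIn x B with x ∈? B
... | yes _ = 1
... | no _  = 0

blocksWith : ℕ → List Seq → ℕ
blocksWith x []       = 0
blocksWith x (B ∷ bs) = isIn x B + blocksWith x bs

isIn-≤1 : ∀ x B → isIn x B ≤ 1
isIn-≤1 x B with x ∈? B
... | yes _ = ≤-refl
... | no _  = z≤n

isIn-∈ : ∀ {x B} → x ∈ B → isIn x B ≡ 1
isIn-∈ {x} {B} x∈B with x ∈? B
... | yes _   = refl
... | no x∉B = ⊥-elim (x∉B x∈B)

isIn-merge : ∀ x P B → ¬ (x ∈ P × x ∈ B) → isIn x P + isIn x B ≤ isIn x (P ++ B)
isIn-merge x P B not-both with x ∈? P | x ∈? B
... | yes x∈P | yes x∈B = ⊥-elim (not-both (x∈P , x∈B))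
... | yes x∈P | no _    = ≤-reflexive (sym (isIn-∈ (∈-++⁺ˡ x∈P)))
... | no _    | yes x∈B = ≤-reflexive (sym (isIn-∈ (∈-++⁺ʳ P x∈B)))
... | no _    | no _    = z≤n

blocksWith-≤-length : ∀ x bs → blocksWith x bs ≤ length bs
blocksWith-≤-length x []       = z≤n
blocksWith-≤-length x (B ∷ bs) = +-mono-≤ (isIn-≤1 x B) (blocksWith-≤-length x bs)

blocksWith-∈ : ∀ x bs → 1 ≤ blocksWith x bs → x ∈ concat bs
blocksWith-∈ x (B ∷ bs) pos with x ∈? B
... | yes x∈B = ∈-++⁺ˡ x∈B
... | no _    = ∈-++⁺ʳ B (blocksWith-∈ x bs pos)

blocksWith-tail : ∀ {t} x B bs → suc t ≤ blocksWith x (B ∷ bs) → t ≤ blocksWith x bs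
blocksWith-tail x B bs h = ≤-pred (≤-trans h (+-monoˡ-≤ (blocksWith x bs) (isIn-≤1 x B)))

blocksWith-merge : ∀ x P B bs → ¬ (x ∈ P × x ∈ B) →
  blocksWith x (P ∷ B ∷ bs) ≤ blocksWith x ((P ++ B) ∷ bs)
blocksWith-merge x P B bs not-both = begin
  isIn x P + (isIn x B + blocksWith x bs) ≡⟨ +-assoc (isIn x P) _ _ ⟨
  isIn x P + isIn x B + blocksWith x bs   ≤⟨ +-monoˡ-≤ _ (isIn-merge x P B not-both) ⟩
  isIn x (P ++ B) + blocksWith x bs       ∎
  where open ≤-Reasoning

-- A duplicate-free block contains x at most once, and not at all if x is
-- absent: the occurrences of x form a duplicate-free list of copies of x.
occ-unique : ∀ x B → Unique B → occ x B ≤ isIn x B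
occ-unique x B B-unique with x ∈? B
... | yes _   = at-most-one (Unique.filter⁺ (x ≟_) B-unique) (All.all-filter (x ≟_) B)
  where
  at-most-one : ∀ {ys} → Unique ys → All (x ≡_) ys → length ys ≤ 1
  at-most-one {[]}        _               _                  = z≤n
  at-most-one {_ ∷ []}    _               _                  = ≤-refl
  at-most-one {_ ∷ _ ∷ _} ((y≢z ∷ _) ∷ _) (refl ∷ refl ∷ _) = ⊥-elim (y≢z refl)
... | no x∉B = ≤-reflexive (cong length (filter-none (x ≟_) (All.¬Any⇒All¬ B x∉B)))

occ-++ : ∀ x v w → occ x (v ++ w) ≡ occ x v + occ x w
occ-++ x v w = trans (cong length (filter-++ (x ≟_) v w)) (length-++ (filter (x ≟_) v))

occ-concat : ∀ x bs → All Unique bs → occ x (concat bs) ≤ blocksWith x bs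
occ-concat x []       []                     = z≤n
occ-concat x (B ∷ bs) (B-unique ∷ bs-unique) = begin
  occ x (B ++ concat bs)         ≡⟨ occ-++ x B (concat bs) ⟩
  occ x B + occ x (concat bs)    ≤⟨ +-mono-≤ (occ-unique x B B-unique) (occ-concat x bs bs-unique) ⟩
  isIn x B + blocksWith x bs     ∎
  where open ≤-Reasoning

-- If some symbol lies in at least t of the blocks bs, there are at least t
-- blocks; this rules out the base cases of the induction.
enough-blocks : ∀ {t x X} bs → All (λ y → t ≤ blocksWith y bs) (x ∷ X) → t ≤ length bs
enough-blocks {x = x} bs (t≤ ∷ _) = ≤-trans t≤ (blocksWith-≤-length x bs)

length-partition : ∀ {Q : ℕ → Set} (Q? : ∀ x → Dec (Q x)) xs →
  length xs ≡ length (filter Q? xs) + length (filter (¬? ∘ Q?) xs)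
length-partition Q? []       = refl
length-partition Q? (x ∷ xs) with Q? x
... | yes _ = cong suc (length-partition Q? xs)
... | no _  = trans (cong suc (length-partition Q? xs)) (sym (+-suc _ _))

pigeonhole : ∀ c a b x y → c * (a + b) < x + y → c * a < x ⊎ c * b < y
pigeonhole c a b x y h with suc (c * a) ≤? x
... | yes ca<x = inj₁ ca<x
... | no ca≮x  = inj₂ (≰⇒> λ y≤cb → ca≮x (+-cancelʳ-≤ y (suc (c * a)) x (begin
  suc (c * a) + y       ≤⟨ +-monoʳ-≤ (suc (c * a)) y≤cb ⟩
  suc (c * a + c * b)   ≡⟨ cong suc (*-distribˡ-+ c a b) ⟨
  suc (c * (a + b))     ≤⟨ h ⟩
  x + y                 ∎)))
  where open ≤-Reasoning

C-mono : ∀ {n n′} k → n ≤ n′ → n C k ≤ n′ C k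
C-mono k = go ∘ ≤⇒≤′
  where
  C-suc : ∀ n k → n C k ≤ suc n C k
  C-suc n zero    = ≤-refl
  C-suc n (suc k) = subst (n C suc k ≤_) (nCk+nC[k+1]≡[n+1]C[k+1] n k) (m≤n+m _ _)
  go : ∀ {n n′} → n ≤′ n′ → n C k ≤ n′ C k
  go ≤′-refl       = ≤-refl
  go (≤′-step n≤n′) = ≤-trans (go n≤n′) (C-suc _ k)

module Chains (r : ℕ) where

  record ChainFrom (X : List ℕ) (t : ℕ) (w : Seq) : Set where
    field
      Y        : List ℕ
      Y-unique : Unique Y
      Y-size   : length Y ≡ r
      Y⊆X      : All (_∈ X) Y
      Y-chain  : Chain Y t w

  open ChainFrom

  chainFrom⇒formation : ∀ {X t w} → ChainFrom X t w → ContainsFormation r t w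
  chainFrom⇒formation c = chain⇒formation (Y-unique c) (Y-size c) (Y-chain c)

  widen : ∀ {X X′ t w} → (∀ {x} → x ∈ X′ → x ∈ X) → ChainFrom X′ t w → ChainFrom X t w
  widen X′⊆X c = record
    { Y = Y c ; Y-unique = Y-unique c ; Y-size = Y-size c
    ; Y⊆X = All.map X′⊆X (Y⊆X c) ; Y-chain = Y-chain c }

  prepend : ∀ {X X′ t w} P → (∀ {x} → x ∈ X′ → x ∈ X × x ∈ P) → ChainFrom X′ t w →
    ChainFrom X (suc t) (P ++ w)
  prepend P X′⊆X∩P c = record
    { Y = Y c ; Y-unique = Y-unique c ; Y-size = Y-size c
    ; Y⊆X = All.map (proj₁ ∘ X′⊆X∩P) (Y⊆X c)
    ; Y-chain = next (All.map (proj₂ ∘ X′⊆X∩P) (Y⊆X c)) (Y-chain c)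
    }

  three-segments : ∀ {P B w} X → Unique X → r ≤ length X →
    All (λ x → x ∈ P × x ∈ B × x ∈ w) X → ChainFrom X 3 (P ++ B ++ w)
  three-segments {P} {B} {w} X X-unique r≤|X| cover = record
    { Y = take r X
    ; Y-unique = Unique.take⁺ r X-unique
    ; Y-size = trans (length-take r X) (m≤n⇒m⊓n≡m r≤|X|)
    ; Y⊆X = All.take⁺ r (All.tabulate (λ x∈X → x∈X))
    ; Y-chain = next (All.map proj₁ cover′) (next (All.map (proj₁ ∘ proj₂) cover′)
                  (last (All.map (proj₂ ∘ proj₂) cover′)))
    }
    where
    cover′ : All (λ x → x ∈ P × x ∈ B × x ∈ w) (take r X)
    cover′ = All.take⁺ r cover

  -- The first block P
  -- is kept apart from L, so that merging P with the next block keeps the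
  -- recursion structural: if every symbol of X lies in at least 3+j of the
  -- blocks P ∷ L and |X| > (r-1)·C(|L|-1, j+1), then r symbols of X form a
  -- (3+j)-chain.
  ChainsFor : List Seq → Set
  ChainsFor L = ∀ j P X → Unique X →
    All (λ x → 3 + j ≤ blocksWith x (P ∷ L)) X →
    (r ∸ 1) * ((length L ∸ 1) C suc j) < length X →
    ChainFrom X (3 + j) (P ++ concat L)

  chains-step : ∀ B B′ L′ → ChainsFor (B′ ∷ L′) → ChainsFor (B ∷ B′ ∷ L′)
  chains-step B B′ L′ ih j P X X-unique many large =
    choose (pigeonhole (r ∸ 1) (length L′ C j) (length L′ C suc j) (length X₁) (length X₂) large′)
    where
    L : List Seq
    L = B′ ∷ L′
    both? : ∀ x → Dec (x ∈ P × x ∈ B)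
    both? x = (x ∈? P) ×-dec (x ∈? B)
    X₁ X₂ : List ℕ
    X₁ = filter both? X
    X₂ = filter (¬? ∘ both?) X

    -- Pascal's rule splits the bound between the two groups.
    large′ : (r ∸ 1) * (length L′ C j + length L′ C suc j) < length X₁ + length X₂
    large′ = subst₂ (λ c n → (r ∸ 1) * c < n)
      (sym (nCk+nC[k+1]≡[n+1]C[k+1] (length L′) j)) (length-partition both? X) large

    -- Symbols lying in both P and B: P is their first segment.
    in-P-and-B : ∀ {x} → x ∈ X₁ → x ∈ P × x ∈ B
    in-P-and-B = proj₂ ∘ ∈-filter⁻ both? {xs = X}
    shared-count : ∀ {x} → x ∈ X₁ → 2 + j ≤ blocksWith x (B ∷ L)
    shared-count x∈X₁ = blocksWith-tail _ P (B ∷ L) (All.lookup many (proj₁ (∈-filter⁻ both? x∈X₁)))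
    -- For 3 segments the chain is P | B | rest; otherwise recurse from B on.
    first-two-shared : ∀ k → All (λ x → 2 + k ≤ blocksWith x (B ∷ L)) X₁ →
      (r ∸ 1) * (length L′ C k) < length X₁ → ChainFrom X₁ (3 + k) (P ++ B ++ concat L)
    first-two-shared zero counts large₁ = three-segments X₁ (Unique.filter⁺ both? X-unique)
      (≤-trans (m≤n+m∸n r 1) (subst (_< length X₁) (*-identityʳ (r ∸ 1)) large₁))
      (All.tabulate λ x∈X₁ → proj₁ (in-P-and-B x∈X₁) , proj₂ (in-P-and-B x∈X₁) ,
         blocksWith-∈ _ L (blocksWith-tail _ B L (All.lookup counts x∈X₁)))
    first-two-shared (suc k) counts large₁ = prepend P (λ x∈X₁ → x∈X₁ , proj₁ (in-P-and-B x∈X₁))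
      (ih k B X₁ (Unique.filter⁺ both? X-unique) counts large₁)

    -- Symbols not in both P and B: merge P and B into one block.
    merged-count : ∀ {x} → x ∈ X₂ → 3 + j ≤ blocksWith x ((P ++ B) ∷ L)
    merged-count x∈X₂ with ∈-filter⁻ (¬? ∘ both?) x∈X₂
    ... | x∈X , not-both = ≤-trans (All.lookup many x∈X) (blocksWith-merge _ P B L not-both)

    choose : (r ∸ 1) * (length L′ C j) < length X₁ ⊎ (r ∸ 1) * (length L′ C suc j) < length X₂ →
      ChainFrom X (3 + j) (P ++ concat (B ∷ L))
    choose (inj₁ large₁) = widen (proj₁ ∘ ∈-filter⁻ both?)
      (first-two-shared j (All.tabulate shared-count) large₁)
    choose (inj₂ large₂) = subst (ChainFrom X (3 + j)) (++-assoc P B (concat L))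
      (widen (proj₁ ∘ ∈-filter⁻ (¬? ∘ both?))
        (ih j (P ++ B) X₂ (Unique.filter⁺ (¬? ∘ both?) X-unique) (All.tabulate merged-count) large₂))

  -- With fewer than three blocks the hypothesis is unsatisfiable (X would be
  -- empty); otherwise apply the induction step.
  chains : ∀ L → ChainsFor L
  chains []                j P (x ∷ X) _ many _ with enough-blocks (P ∷ []) many
  ... | s≤s ()
  chains (B ∷ [])          j P (x ∷ X) _ many _ with enough-blocks (P ∷ B ∷ []) many
  ... | s≤s (s≤s ())
  chains (B ∷ B′ ∷ L′)   = chains-step B B′ L′ (chains (B′ ∷ L′))

open Chains using (chains; chainFrom⇒formation)

-- The theorem: a larger symbol set would force an (r,s)-formation.
lemma5p10 : ∀ (r s m : ℕ) → 2 ≤ r → 3 ≤ s → 1 ≤ m →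
    ∀ (u : Seq) → AFF r s s m u →
    distinct u ≤ (r ∸ 1) * ((m ∸ 2) C (s ∸ 2))
lemma5p10 r (suc (suc (suc j))) m _ (s≤s (s≤s (s≤s _))) _ u (_ , ([] , _ , refl , _) , _) = z≤n
lemma5p10 r s@(suc (suc (suc j))) m _ (s≤s (s≤s (s≤s _))) _ u
  (no-formation , (P ∷ L , #blocks≤m , concat≡u , blocks-unique) , occ≥s) =
  ≮⇒≥ λ many → no-formation (subst (ContainsFormation r s) concat≡u (chainFrom⇒formation r
    (chains r L j P X (deduplicate-! u) in-s-blocks (≤-<-trans fewer-blocks many))))
  where
  X : List ℕ
  X = deduplicate _≟_ u
  -- Each symbol occurs s times, at most once per block.
  in-s-blocks : All (λ x → s ≤ blocksWith x (P ∷ L)) X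
  in-s-blocks = All.tabulate λ {x} x∈X →
    ≤-trans (occ≥s x (∈-deduplicate⁻ _≟_ u x∈X))
      (subst (λ v → occ x v ≤ blocksWith x (P ∷ L)) concat≡u (occ-concat x (P ∷ L) blocks-unique))
  -- At most m blocks: the bound at |L| = (number of blocks) - 1 is below the claimed one.
  fewer-blocks : (r ∸ 1) * ((length L ∸ 1) C suc j) ≤ (r ∸ 1) * ((m ∸ 2) C suc j)
  fewer-blocks = *-monoʳ-≤ (r ∸ 1) (C-mono (suc j) (∸-monoˡ-≤ 2 #blocks≤m))
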